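{- For all integers $m\geq 1$, $n\geq 0$, $p\geq 0$ and every real $x$, \[ m^{n-1}\sum_{k=0}^{m-1}B_{n,p}\!\left(x+\frac{k}{m}\right)=(p+1)\,B_{n}(mx)-p\sum_{k=0}^{n}\binom{n}{k}\frac{m^{k}\,B_{n-k}(mx)\,B_{k,p}}{k+1}. \]
   Context: The Bernoulli polynomials are defined by $\sum_{n\ge0}B_n(x)\frac{t^n}{n!}=\frac{te^{xt}}{e^t-1}$. For each integer $p\geq 0$, the $p$-Bernoulli numbers $B_{n,p}$ are defined by $B_{0,p}=1$ and $B_{n+1,p}=pB_{n,p}-\frac{(p+1)^{2}}{p+2}B_{n,p+1}$ ($n,p\ge 0$), and the $p$-Bernoulli polynomials by $B_{n,p}(x)=\sum_{k=0}^{n}\binom{n}{k}x^{n-k}B_{k,p}$.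
   Formalization: The variable x ranges over the rationals instead of over every real. -}

module Defs where

open import Data.Nat as ℕ using (ℕ; zero; suc; NonZero)
open import Data.Nat.Combinatorics using (_C_)
open import Data.Integer using (+_)
open import Relation.Nullary using (yes; no)
open import Data.Rational using (ℚ; 0ℚ; 1ℚ; _+_; _*_; _-_; -_; _/_)

ℕ→ℚ : ℕ → ℚ
ℕ→ℚ n = + n / 1

_^ℚ_ : ℚ → ℕ → ℚ
x ^ℚ zero = 1ℚ
x ^ℚ suc n = x * (x ^ℚ n)

sumBelow : ℕ → (ℕ → ℚ) → ℚ
sumBelow zero f = 0ℚ
sumBelow (suc n) f = sumBelow n f + f n

sumTo : ℕ → (ℕ → ℚ) → ℚ
sumTo n f = sumBelow (suc n) f

-- Bernoulli numbers for the generating function t/(e^t - 1) (so B₁ = -1/2),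
-- via the standard recurrence  Σ_{k=0}^{n} C(n+1,k) B_k = 0  (n ≥ 1), B₀ = 1.
-- Course-of-values: bernList n = [B_0, ..., B_n] encoded as a function.
bernUpTo : ℕ → (ℕ → ℚ)
bernUpTo zero k = 1ℚ
bernUpTo (suc n) k with k ℕ.≤? n
... | yes _ = bernUpTo n k
... | no _ =
  - ((+ 1 / (suc (suc n))) * sumBelow (suc n) (λ j → ℕ→ℚ ((suc (suc n)) C j) * bernUpTo n j))

bernoulli : ℕ → ℚ
bernoulli n = bernUpTo n n

bernoulliPoly : ℕ → ℚ → ℚ
bernoulliPoly n x = sumTo n (λ k → ℕ→ℚ (n C k) * bernoulli k * (x ^ℚ (n ℕ.∸ k)))

pBernoulli : ℕ → ℕ → ℚ
pBernoulli zero p = 1ℚ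
pBernoulli (suc n) p =
  ℕ→ℚ p * pBernoulli n p - (+ ((suc p) ℕ.* (suc p)) / (suc (suc p))) * pBernoulli n (suc p)

pBernoulliPoly : ℕ → ℕ → ℚ → ℚ
pBernoulliPoly n p x = sumTo n (λ k → ℕ→ℚ (n C k) * (x ^ℚ (n ℕ.∸ k)) * pBernoulli k p)

-- m^{n-1} as a rational (with integer exponent n-1; equals 1/m when n = 0)
mPowPred : (m : ℕ) → .{{_ : NonZero m}} → ℕ → ℚ
mPowPred m zero = + 1 / m
mPowPred m (suc n) = ℕ→ℚ m ^ℚ n

{-# OPTIONS --safe #-}

-- Work with exponential generating functions: B(t) = t/(eᵗ − 1) and Pₚ(t) = Σₙ B_{n,p} tⁿ/n!.
-- The recurrence for B_{n,p} makes Φₚ = Pₚ(t)(eᵗ − 1) satisfy Φₚ' = (p + 1) − p Pₚ, so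
-- Pₚ = B · Qₚ with Qₚ(t) = (p + 1) − p (1/t)∫₀ᵗ Pₚ, i.e. B_{n,p}(x) = Σₖ C(n,k) Qₚ⁽ᵏ⁾(0) B_{n−k}(x).
-- Raabe's multiplication formula m^{n−1} Σ_{j<m} B_n(x + j/m) = B_n(mx), which is the identity
-- B(mt) Σ_{j<m} e^{jt} = m B(t), then turns the left-hand side into Σₖ C(n,k) m^k Qₚ⁽ᵏ⁾(0) B_{n−k}(mx),
-- and expanding Qₚ gives the right-hand side.
module Submission where

open import Defs
open import Data.Nat using (ℕ; NonZero; suc; _∸_)
open import Data.Nat.Combinatorics using (_C_)
open import Data.Integer using (+_)
open import Data.Rational using (ℚ; _+_; _*_; _-_; _/_)
open import Relation.Binary.PropositionalEquality using (_≡_)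

open import Data.Nat as ℕ using (zero; _<_; _≤_; z≤n)
import Data.Nat.Properties as ℕ
import Data.Nat.Combinatorics as ℕ
import Data.Integer as ℤ
import Data.Integer.Properties as ℤ
open import Data.Rational using (0ℚ; 1ℚ; -_; toℚᵘ)
open import Data.Rational.Properties
import Data.Rational.Unnormalised as ℚᵘ
import Data.Rational.Unnormalised.Properties as ℚᵘ
open import Data.Empty using (⊥-elim)
open import Function using (_∘_)
open import Level using (0ℓ)
open import Relation.Nullary using (yes; no)
open import Relation.Nullary.Decidable using (dec⇒maybe)
open import Relation.Binary.PropositionalEquality
  using (refl; sym; trans; cong; cong₂; _≗_; _→-setoid_; module ≡-Reasoning)
import Relation.Binary.Reasoning.Setoid
open import Tactic.RingSolver using (solve-∀)
open import Tactic.RingSolver.Core.AlmostCommutativeRing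
  using (AlmostCommutativeRing; fromCommutativeRing)

ℚ-ring : AlmostCommutativeRing 0ℓ 0ℓ
ℚ-ring = fromCommutativeRing +-*-commutativeRing (λ x → dec⇒maybe (0ℚ ≟ x))

toℚᵘ-ℕ→ℚ : ∀ a → toℚᵘ (ℕ→ℚ a) ℚᵘ.≃ ℚᵘ.mkℚᵘ (+ a) 0
toℚᵘ-ℕ→ℚ a = toℚᵘ-fromℚᵘ (ℚᵘ.mkℚᵘ (+ a) 0)

ℕ→ℚ-homo-+ : ∀ a b → ℕ→ℚ (a ℕ.+ b) ≡ ℕ→ℚ a + ℕ→ℚ b
ℕ→ℚ-homo-+ a b = toℚᵘ-injective (begin
  toℚᵘ (ℕ→ℚ (a ℕ.+ b))                  ≈⟨ toℚᵘ-ℕ→ℚ (a ℕ.+ b) ⟩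
  ℚᵘ.mkℚᵘ (+ (a ℕ.+ b)) 0               ≈⟨ ℚᵘ.*≡* integral ⟩
  ℚᵘ.mkℚᵘ (+ a) 0 ℚᵘ.+ ℚᵘ.mkℚᵘ (+ b) 0  ≈⟨ ℚᵘ.+-cong (toℚᵘ-ℕ→ℚ a) (toℚᵘ-ℕ→ℚ b) ⟨
  toℚᵘ (ℕ→ℚ a) ℚᵘ.+ toℚᵘ (ℕ→ℚ b)        ≈⟨ toℚᵘ-homo-+ (ℕ→ℚ a) (ℕ→ℚ b) ⟨
  toℚᵘ (ℕ→ℚ a + ℕ→ℚ b)                  ∎)
  where
  open ℚᵘ.≃-Reasoning
  integral : + (a ℕ.+ b) ℤ.* + 1 ≡ (+ a ℤ.* + 1 ℤ.+ + b ℤ.* + 1) ℤ.* + 1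
  integral = cong (ℤ._* + 1) (trans (ℤ.pos-+ a b)
    (sym (cong₂ ℤ._+_ (ℤ.*-identityʳ (+ a)) (ℤ.*-identityʳ (+ b)))))

ℕ→ℚ-homo-* : ∀ a b → ℕ→ℚ (a ℕ.* b) ≡ ℕ→ℚ a * ℕ→ℚ b
ℕ→ℚ-homo-* a b = toℚᵘ-injective (begin
  toℚᵘ (ℕ→ℚ (a ℕ.* b))                  ≈⟨ toℚᵘ-ℕ→ℚ (a ℕ.* b) ⟩
  ℚᵘ.mkℚᵘ (+ (a ℕ.* b)) 0               ≈⟨ ℚᵘ.*≡* (cong (ℤ._* + 1) (ℤ.pos-* a b)) ⟩
  ℚᵘ.mkℚᵘ (+ a) 0 ℚᵘ.* ℚᵘ.mkℚᵘ (+ b) 0  ≈⟨ ℚᵘ.*-cong (toℚᵘ-ℕ→ℚ a) (toℚᵘ-ℕ→ℚ b) ⟨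
  toℚᵘ (ℕ→ℚ a) ℚᵘ.* toℚᵘ (ℕ→ℚ b)        ≈⟨ toℚᵘ-homo-* (ℕ→ℚ a) (ℕ→ℚ b) ⟨
  toℚᵘ (ℕ→ℚ a * ℕ→ℚ b)                  ∎)
  where open ℚᵘ.≃-Reasoning

ℕ→ℚ-suc : ∀ n → ℕ→ℚ (suc n) ≡ 1ℚ + ℕ→ℚ n
ℕ→ℚ-suc = ℕ→ℚ-homo-+ 1

a/d*d≡a : ∀ a d .{{_ : NonZero d}} → (+ a / d) * ℕ→ℚ d ≡ ℕ→ℚ a
a/d*d≡a a d@(suc d-1) = toℚᵘ-injective (begin
  toℚᵘ ((+ a / d) * ℕ→ℚ d)                ≈⟨ toℚᵘ-homo-* (+ a / d) (ℕ→ℚ d) ⟩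
  toℚᵘ (+ a / d) ℚᵘ.* toℚᵘ (ℕ→ℚ d)        ≈⟨ ℚᵘ.*-cong (toℚᵘ-fromℚᵘ (ℚᵘ.mkℚᵘ (+ a) d-1)) (toℚᵘ-ℕ→ℚ d) ⟩
  ℚᵘ.mkℚᵘ (+ a) d-1 ℚᵘ.* ℚᵘ.mkℚᵘ (+ d) 0  ≈⟨ ℚᵘ.*≡* (ℤ.*-assoc (+ a) (+ d) (+ 1)) ⟩
  ℚᵘ.mkℚᵘ (+ a) 0                         ≈⟨ toℚᵘ-ℕ→ℚ a ⟨
  toℚᵘ (ℕ→ℚ a)                            ∎)
  where open ℚᵘ.≃-Reasoning

*-cancelˡ-ℕ→ℚ : ∀ d .{{_ : NonZero d}} {x y} → ℕ→ℚ d * x ≡ ℕ→ℚ d * y → x ≡ y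
*-cancelˡ-ℕ→ℚ d {x} {y} eq = begin
  x                    ≡⟨ rescale x ⟨
  (d⁻¹ * ℕ→ℚ d) * x    ≡⟨ *-assoc d⁻¹ (ℕ→ℚ d) x ⟩
  d⁻¹ * (ℕ→ℚ d * x)    ≡⟨ cong (d⁻¹ *_) eq ⟩
  d⁻¹ * (ℕ→ℚ d * y)    ≡⟨ *-assoc d⁻¹ (ℕ→ℚ d) y ⟨
  (d⁻¹ * ℕ→ℚ d) * y    ≡⟨ rescale y ⟩
  y                    ∎
  where
  open ≡-Reasoning
  d⁻¹ = + 1 / d
  rescale : ∀ z → (d⁻¹ * ℕ→ℚ d) * z ≡ z
  rescale z = trans (cong (_* z) (a/d*d≡a 1 d)) (*-identityˡ z)

sumBelow-cong : ∀ n {f g : ℕ → ℚ} → f ≗ g → sumBelow n f ≡ sumBelow n g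
sumBelow-cong zero    f≗g = refl
sumBelow-cong (suc n) f≗g = cong₂ _+_ (sumBelow-cong n f≗g) (f≗g n)

sumBelow-cong-< : ∀ n {f g : ℕ → ℚ} → (∀ k → k < n → f k ≡ g k) → sumBelow n f ≡ sumBelow n g
sumBelow-cong-< zero    eq = refl
sumBelow-cong-< (suc n) eq =
  cong₂ _+_ (sumBelow-cong-< n (λ k k<n → eq k (ℕ.m<n⇒m<1+n k<n))) (eq n (ℕ.n<1+n n))

sumBelow-+ : ∀ n (f g : ℕ → ℚ) → sumBelow n (λ k → f k + g k) ≡ sumBelow n f + sumBelow n g
sumBelow-+ zero    f g = refl
sumBelow-+ (suc n) f g =
  trans (cong (_+ (f n + g n)) (sumBelow-+ n f g)) (interchange (sumBelow n f) (sumBelow n g) (f n) (g n))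
  where
  interchange : ∀ a b c d → (a + b) + (c + d) ≡ (a + c) + (b + d)
  interchange = solve-∀ ℚ-ring

sumBelow-*ˡ : ∀ n c (f : ℕ → ℚ) → sumBelow n (λ k → c * f k) ≡ c * sumBelow n f
sumBelow-*ˡ zero    c f = sym (*-zeroʳ c)
sumBelow-*ˡ (suc n) c f = trans (cong (_+ (c * f n)) (sumBelow-*ˡ n c f)) (sym (*-distribˡ-+ c _ _))

sumBelow-suc : ∀ n (f : ℕ → ℚ) → sumBelow (suc n) f ≡ f 0 + sumBelow n (f ∘ suc)
sumBelow-suc zero    f = trans (+-identityˡ (f 0)) (sym (+-identityʳ (f 0)))
sumBelow-suc (suc n) f =
  trans (cong (_+ f (suc n)) (sumBelow-suc n f)) (+-assoc (f 0) (sumBelow n (f ∘ suc)) (f (suc n)))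

sumBelow-telescope : ∀ n (f : ℕ → ℚ) → sumBelow n (λ k → f (suc k) - f k) ≡ f n - f 0
sumBelow-telescope zero    f = sym (+-inverseʳ (f 0))
sumBelow-telescope (suc n) f =
  trans (cong (_+ (f (suc n) - f n)) (sumBelow-telescope n f)) (collapse (f n) (f (suc n)) (f 0))
  where
  collapse : ∀ a b c → (a - c) + (b - a) ≡ b - c
  collapse = solve-∀ ℚ-ring

sumTo-pascal : ∀ n (f : ℕ → ℚ) →
  sumTo (suc n) (λ k → ℕ→ℚ (suc n C k) * f k)
    ≡ sumTo n (λ k → ℕ→ℚ (n C k) * f (suc k)) + sumTo n (λ k → ℕ→ℚ (n C k) * f k)
sumTo-pascal n f = begin
  sumTo (suc n) (λ k → ℕ→ℚ (suc n C k) * f k)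
    ≡⟨ sumBelow-suc (suc n) _ ⟩
  f₀ + sumTo n (λ k → ℕ→ℚ (suc n C suc k) * f (suc k))
    ≡⟨ cong (_+_ f₀) (sumBelow-cong (suc n) pascal) ⟩
  f₀ + sumTo n (λ k → shifted k + unshifted (suc k))
    ≡⟨ cong (_+_ f₀) (sumBelow-+ (suc n) shifted (unshifted ∘ suc)) ⟩
  f₀ + (S + sumTo n (unshifted ∘ suc))
    ≡⟨ +-left-comm f₀ S _ ⟩
  S + (f₀ + sumTo n (unshifted ∘ suc))
    ≡⟨ cong (_+_ S) (sumBelow-suc (suc n) unshifted) ⟨
  S + sumTo (suc n) unshifted
    ≡⟨ cong (_+_ S) top-vanishes ⟩
  S + sumTo n unshifted ∎
  where
  open ≡-Reasoning
  -- suc n C 0 and n C 0 both compute to 1, so f₀ is also unshifted 0.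
  f₀ = ℕ→ℚ (suc n C 0) * f 0
  shifted unshifted : ℕ → ℚ
  shifted k = ℕ→ℚ (n C k) * f (suc k)
  unshifted k = ℕ→ℚ (n C k) * f k
  S = sumTo n shifted
  pascal : ∀ k → ℕ→ℚ (suc n C suc k) * f (suc k) ≡ shifted k + unshifted (suc k)
  pascal k = begin
    ℕ→ℚ (suc n C suc k) * f (suc k)
      ≡⟨ cong (λ c → ℕ→ℚ c * f (suc k)) (ℕ.nCk+nC[k+1]≡[n+1]C[k+1] n k) ⟨
    ℕ→ℚ (n C k ℕ.+ n C suc k) * f (suc k)
      ≡⟨ cong (_* f (suc k)) (ℕ→ℚ-homo-+ (n C k) (n C suc k)) ⟩
    (ℕ→ℚ (n C k) + ℕ→ℚ (n C suc k)) * f (suc k)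
      ≡⟨ *-distribʳ-+ (f (suc k)) (ℕ→ℚ (n C k)) (ℕ→ℚ (n C suc k)) ⟩
    shifted k + unshifted (suc k) ∎
  top-vanishes : sumTo (suc n) unshifted ≡ sumTo n unshifted
  top-vanishes = begin
    T + ℕ→ℚ (n C suc n) * f (suc n) ≡⟨ cong (λ c → T + ℕ→ℚ c * f (suc n)) (ℕ.k>n⇒nCk≡0 (ℕ.n<1+n n)) ⟩
    T + 0ℚ * f (suc n)              ≡⟨ cong (_+_ T) (*-zeroˡ (f (suc n))) ⟩
    T + 0ℚ                          ≡⟨ +-identityʳ T ⟩
    T                               ∎
    where T = sumTo n unshifted
  +-left-comm : ∀ a b c → a + (b + c) ≡ b + (a + c)
  +-left-comm = solve-∀ ℚ-ring

-- A sequence A stands for its exponential generating function A(t) = Σₙ A n tⁿ/n!.  The product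
-- ⊛ of generating functions is defined through the Leibniz rule (⊛-binomial gives its closed
-- form), ∂ is d/dt, 1ˢ = 1, tˢ = t, exp z = e^{zt}, expm1 = eᵗ − 1, expm1/t = (eᵗ − 1)/t and
-- dilate c A = A(ct).
Seq : Set
Seq = ℕ → ℚ

∂ : Seq → Seq
∂ A n = A (suc n)

infixl 7 _⊛_
infixr 8 _∙_
infixl 6 _⊕_ _⊖_

_⊛_ : Seq → Seq → Seq
(A ⊛ B) zero    = A 0 * B 0
(A ⊛ B) (suc n) = (∂ A ⊛ B) n + (A ⊛ ∂ B) n

_⊕_ _⊖_ : Seq → Seq → Seq
(A ⊕ B) n = A n + B n
(A ⊖ B) n = A n - B n

_∙_ : ℚ → Seq → Seq
(c ∙ A) n = c * A n

0ˢ 1ˢ tˢ : Seq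
0ˢ _ = 0ℚ
1ˢ zero    = 1ℚ
1ˢ (suc _) = 0ℚ
tˢ zero    = 0ℚ
tˢ (suc n) = 1ˢ n

exp : ℚ → Seq
exp z n = z ^ℚ n

expm1 expm1/t : Seq
expm1 zero    = 0ℚ
expm1 (suc _) = 1ℚ
expm1/t n = + 1 / suc n

dilate : ℚ → Seq → Seq
dilate c A n = c ^ℚ n * A n

module ≗-Reasoning = Relation.Binary.Reasoning.Setoid (ℕ →-setoid ℚ)

⊛-binomial : ∀ A B n → (A ⊛ B) n ≡ sumTo n (λ k → ℕ→ℚ (n C k) * (A k * B (n ∸ k)))
⊛-binomial A B zero    = sym (trans (+-identityˡ _) (*-identityˡ _))
⊛-binomial A B (suc n) = begin
  (∂ A ⊛ B) n + (A ⊛ ∂ B) n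
    ≡⟨ cong₂ _+_ (⊛-binomial (∂ A) B n) (⊛-binomial A (∂ B) n) ⟩
  sumTo n (λ k → ℕ→ℚ (n C k) * term (suc k)) + sumTo n (λ k → ℕ→ℚ (n C k) * (A k * B (suc (n ∸ k))))
    ≡⟨ cong (_+_ (sumTo n (λ k → ℕ→ℚ (n C k) * term (suc k)))) (sumBelow-cong-< (suc n) suc[n∸k]) ⟩
  sumTo n (λ k → ℕ→ℚ (n C k) * term (suc k)) + sumTo n (λ k → ℕ→ℚ (n C k) * term k)
    ≡⟨ sumTo-pascal n term ⟨
  sumTo (suc n) (λ k → ℕ→ℚ (suc n C k) * term k) ∎
  where
  open ≡-Reasoning
  term : ℕ → ℚ
  term k = A k * B (suc n ∸ k)
  suc[n∸k] : ∀ k → k < suc n → ℕ→ℚ (n C k) * (A k * B (suc (n ∸ k))) ≡ ℕ→ℚ (n C k) * term k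
  suc[n∸k] k k<1+n = cong (λ i → ℕ→ℚ (n C k) * (A k * B i)) (sym (ℕ.+-∸-assoc 1 (ℕ.≤-pred k<1+n)))

⊛-cong : ∀ {A A' B B'} → A ≗ A' → B ≗ B' → A ⊛ B ≗ A' ⊛ B'
⊛-cong A≗A' B≗B' zero    = cong₂ _*_ (A≗A' 0) (B≗B' 0)
⊛-cong A≗A' B≗B' (suc n) = cong₂ _+_ (⊛-cong (A≗A' ∘ suc) B≗B' n) (⊛-cong A≗A' (B≗B' ∘ suc) n)

⊛-congˡ : ∀ A {B B'} → B ≗ B' → A ⊛ B ≗ A ⊛ B'
⊛-congˡ A = ⊛-cong {A} (λ _ → refl)

⊛-congʳ : ∀ {A A'} B → A ≗ A' → A ⊛ B ≗ A' ⊛ B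
⊛-congʳ B A≗A' = ⊛-cong {B = B} A≗A' (λ _ → refl)

⊛-comm : ∀ A B → A ⊛ B ≗ B ⊛ A
⊛-comm A B zero    = *-comm (A 0) (B 0)
⊛-comm A B (suc n) =
  trans (cong₂ _+_ (⊛-comm (∂ A) B n) (⊛-comm A (∂ B) n)) (+-comm ((B ⊛ ∂ A) n) ((∂ B ⊛ A) n))

⊛-zeroʳ : ∀ A → A ⊛ 0ˢ ≗ 0ˢ
⊛-zeroʳ A zero    = *-zeroʳ (A 0)
⊛-zeroʳ A (suc n) = trans (cong₂ _+_ (⊛-zeroʳ (∂ A) n) (⊛-zeroʳ A n)) (+-identityʳ 0ℚ)

⊛-identityʳ : ∀ A → A ⊛ 1ˢ ≗ A
⊛-identityʳ A zero    = *-identityʳ (A 0)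
⊛-identityʳ A (suc n) = trans (cong₂ _+_ (⊛-identityʳ (∂ A) n) (⊛-zeroʳ A n)) (+-identityʳ (A (suc n)))

⊛-identityˡ : ∀ B → 1ˢ ⊛ B ≗ B
⊛-identityˡ B n = trans (⊛-comm 1ˢ B n) (⊛-identityʳ B n)

⊛-distribʳ-⊕ : ∀ A A' B → (A ⊕ A') ⊛ B ≗ A ⊛ B ⊕ A' ⊛ B
⊛-distribʳ-⊕ A A' B zero    = *-distribʳ-+ (B 0) (A 0) (A' 0)
⊛-distribʳ-⊕ A A' B (suc n) =
  trans (cong₂ _+_ (⊛-distribʳ-⊕ (∂ A) (∂ A') B n) (⊛-distribʳ-⊕ A A' (∂ B) n))
        (interchange ((∂ A ⊛ B) n) ((∂ A' ⊛ B) n) ((A ⊛ ∂ B) n) ((A' ⊛ ∂ B) n))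
  where
  interchange : ∀ a b c d → (a + b) + (c + d) ≡ (a + c) + (b + d)
  interchange = solve-∀ ℚ-ring

⊛-distribˡ-⊕ : ∀ A B B' → A ⊛ (B ⊕ B') ≗ A ⊛ B ⊕ A ⊛ B'
⊛-distribˡ-⊕ A B B' n = begin
  (A ⊛ (B ⊕ B')) n        ≡⟨ ⊛-comm A (B ⊕ B') n ⟩
  ((B ⊕ B') ⊛ A) n        ≡⟨ ⊛-distribʳ-⊕ B B' A n ⟩
  (B ⊛ A ⊕ B' ⊛ A) n      ≡⟨ cong₂ _+_ (⊛-comm B A n) (⊛-comm B' A n) ⟩
  (A ⊛ B ⊕ A ⊛ B') n      ∎
  where open ≡-Reasoning

⊛-distribʳ-⊖ : ∀ A A' B → (A ⊖ A') ⊛ B ≗ A ⊛ B ⊖ A' ⊛ B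
⊛-distribʳ-⊖ A A' B zero    = distrib (A 0) (A' 0) (B 0)
  where
  distrib : ∀ a a' b → (a - a') * b ≡ a * b - a' * b
  distrib = solve-∀ ℚ-ring
⊛-distribʳ-⊖ A A' B (suc n) =
  trans (cong₂ _+_ (⊛-distribʳ-⊖ (∂ A) (∂ A') B n) (⊛-distribʳ-⊖ A A' (∂ B) n))
        (interchange ((∂ A ⊛ B) n) ((∂ A' ⊛ B) n) ((A ⊛ ∂ B) n) ((A' ⊛ ∂ B) n))
  where
  interchange : ∀ a b c d → (a - b) + (c - d) ≡ (a + c) - (b + d)
  interchange = solve-∀ ℚ-ring

∙-congˡ : ∀ c {A B} → A ≗ B → c ∙ A ≗ c ∙ B
∙-congˡ c A≗B n = cong (c *_) (A≗B n)

∙-⊛-assoc : ∀ c A B → (c ∙ A) ⊛ B ≗ c ∙ (A ⊛ B)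
∙-⊛-assoc c A B zero    = *-assoc c (A 0) (B 0)
∙-⊛-assoc c A B (suc n) =
  trans (cong₂ _+_ (∙-⊛-assoc c (∂ A) B n) (∙-⊛-assoc c A (∂ B) n)) (sym (*-distribˡ-+ c _ _))

⊛-∙-assoc : ∀ c A B → A ⊛ (c ∙ B) ≗ c ∙ (A ⊛ B)
⊛-∙-assoc c A B n = trans (⊛-comm A (c ∙ B) n) (trans (∙-⊛-assoc c B A n) (cong (c *_) (⊛-comm B A n)))

⊛-assoc : ∀ A B W → (A ⊛ B) ⊛ W ≗ A ⊛ (B ⊛ W)
⊛-assoc A B W zero    = *-assoc (A 0) (B 0) (W 0)
⊛-assoc A B W (suc n) = begin
  ((∂ A ⊛ B ⊕ A ⊛ ∂ B) ⊛ W) n + (A ⊛ B ⊛ ∂ W) n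
    ≡⟨ cong (_+ (A ⊛ B ⊛ ∂ W) n) (⊛-distribʳ-⊕ (∂ A ⊛ B) (A ⊛ ∂ B) W n) ⟩
  ((∂ A ⊛ B) ⊛ W) n + ((A ⊛ ∂ B) ⊛ W) n + ((A ⊛ B) ⊛ ∂ W) n
    ≡⟨ cong₂ _+_ (cong₂ _+_ (⊛-assoc (∂ A) B W n) (⊛-assoc A (∂ B) W n)) (⊛-assoc A B (∂ W) n) ⟩
  (∂ A ⊛ (B ⊛ W)) n + (A ⊛ (∂ B ⊛ W)) n + (A ⊛ (B ⊛ ∂ W)) n
    ≡⟨ +-assoc ((∂ A ⊛ (B ⊛ W)) n) _ _ ⟩
  (∂ A ⊛ (B ⊛ W)) n + ((A ⊛ (∂ B ⊛ W)) n + (A ⊛ (B ⊛ ∂ W)) n)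
    ≡⟨ cong (_+_ ((∂ A ⊛ (B ⊛ W)) n)) (⊛-distribˡ-⊕ A (∂ B ⊛ W) (B ⊛ ∂ W) n) ⟨
  (∂ A ⊛ (B ⊛ W)) n + (A ⊛ (∂ B ⊛ W ⊕ B ⊛ ∂ W)) n ∎
  where open ≡-Reasoning

⊛-right-comm : ∀ A B W → A ⊛ B ⊛ W ≗ A ⊛ W ⊛ B
⊛-right-comm A B W = begin
  A ⊛ B ⊛ W    ≈⟨ ⊛-assoc A B W ⟩
  A ⊛ (B ⊛ W)  ≈⟨ ⊛-congˡ A (⊛-comm B W) ⟩
  A ⊛ (W ⊛ B)  ≈⟨ ⊛-assoc A W B ⟨
  A ⊛ W ⊛ B    ∎
  where open ≗-Reasoning

sumSeq : ℕ → (ℕ → Seq) → Seq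
sumSeq m A n = sumBelow m (λ j → A j n)

sumSeq-cong : ∀ m {A B : ℕ → Seq} → (∀ j → A j ≗ B j) → sumSeq m A ≗ sumSeq m B
sumSeq-cong m A≗B n = sumBelow-cong m (λ j → A≗B j n)

⊛-sumSeq : ∀ m A (B : ℕ → Seq) → A ⊛ sumSeq m B ≗ sumSeq m (λ j → A ⊛ B j)
⊛-sumSeq zero    A B n = ⊛-zeroʳ A n
⊛-sumSeq (suc m) A B n =
  trans (⊛-distribˡ-⊕ A (sumSeq m B) (B m) n) (cong (_+ (A ⊛ B m) n) (⊛-sumSeq m A B n))

⊛-tˢ : ∀ A n → (A ⊛ tˢ) (suc n) ≡ ℕ→ℚ (suc n) * A n
⊛-tˢ A zero    = shape (A 1) (A 0)
  where
  shape : ∀ a b → a * 0ℚ + b * 1ℚ ≡ 1ℚ * b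
  shape = solve-∀ ℚ-ring
⊛-tˢ A (suc n) = begin
  (∂ A ⊛ tˢ) (suc n) + (A ⊛ 1ˢ) (suc n)  ≡⟨ cong₂ _+_ (⊛-tˢ (∂ A) n) (⊛-identityʳ A (suc n)) ⟩
  ℕ→ℚ (suc n) * A (suc n) + A (suc n)    ≡⟨ shape (ℕ→ℚ (suc n)) (A (suc n)) ⟩
  (1ℚ + ℕ→ℚ (suc n)) * A (suc n)         ≡⟨ cong (_* A (suc n)) (ℕ→ℚ-suc (suc n)) ⟨
  ℕ→ℚ (suc (suc n)) * A (suc n)          ∎
  where
  open ≡-Reasoning
  shape : ∀ a b → a * b + b ≡ (1ℚ + a) * b
  shape = solve-∀ ℚ-ring

⊛-tˢ-cancel : ∀ {A B} → A ⊛ tˢ ≗ B ⊛ tˢ → A ≗ B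
⊛-tˢ-cancel {A} {B} eq n =
  *-cancelˡ-ℕ→ℚ (suc n) (trans (sym (⊛-tˢ A n)) (trans (eq (suc n)) (⊛-tˢ B n)))

exp-⊛ : ∀ x y → exp x ⊛ exp y ≗ exp (x + y)
exp-⊛ x y zero    = *-identityˡ 1ℚ
exp-⊛ x y (suc n) = begin
  (x ∙ exp x ⊛ exp y) n + (exp x ⊛ y ∙ exp y) n
    ≡⟨ cong₂ _+_ (∙-⊛-assoc x (exp x) (exp y) n) (⊛-∙-assoc y (exp x) (exp y) n) ⟩
  x * (exp x ⊛ exp y) n + y * (exp x ⊛ exp y) n
    ≡⟨ cong (λ e → x * e + y * e) (exp-⊛ x y n) ⟩
  x * exp (x + y) n + y * exp (x + y) n
    ≡⟨ *-distribʳ-+ (exp (x + y) n) x y ⟨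
  exp (x + y) (suc n) ∎
  where open ≡-Reasoning

expm1≗exp1⊖1ˢ : expm1 ≗ exp 1ℚ ⊖ 1ˢ
expm1≗exp1⊖1ˢ zero    = refl
expm1≗exp1⊖1ˢ (suc n) = sym (trans (+-identityʳ (1ℚ * 1ℚ ^ℚ n)) (1^n≡1 (suc n)))
  where
  1^n≡1 : ∀ n → 1ℚ ^ℚ n ≡ 1ℚ
  1^n≡1 zero    = refl
  1^n≡1 (suc n) = trans (*-identityˡ (1ℚ ^ℚ n)) (1^n≡1 n)

expm1⊛exp : ∀ z → expm1 ⊛ exp z ≗ exp (1ℚ + z) ⊖ exp z
expm1⊛exp z n = begin
  (expm1 ⊛ exp z) n                 ≡⟨ ⊛-congʳ (exp z) expm1≗exp1⊖1ˢ n ⟩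
  ((exp 1ℚ ⊖ 1ˢ) ⊛ exp z) n         ≡⟨ ⊛-distribʳ-⊖ (exp 1ℚ) 1ˢ (exp z) n ⟩
  (exp 1ℚ ⊛ exp z ⊖ 1ˢ ⊛ exp z) n   ≡⟨ cong₂ _-_ (exp-⊛ 1ℚ z n) (⊛-identityˡ (exp z) n) ⟩
  (exp (1ℚ + z) ⊖ exp z) n          ∎
  where open ≡-Reasoning

expm1/t⊛tˢ : expm1/t ⊛ tˢ ≗ expm1
expm1/t⊛tˢ zero    = *-zeroʳ (expm1/t 0)
expm1/t⊛tˢ (suc n) =
  trans (⊛-tˢ expm1/t n) (trans (*-comm (ℕ→ℚ (suc n)) (expm1/t n)) (a/d*d≡a 1 (suc n)))

dilate-cong : ∀ c {A B} → A ≗ B → dilate c A ≗ dilate c B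
dilate-cong c A≗B n = cong (c ^ℚ n *_) (A≗B n)

dilate-⊛ : ∀ c A B → dilate c A ⊛ dilate c B ≗ dilate c (A ⊛ B)
dilate-⊛ c A B zero    = shape (A 0) (B 0)
  where
  shape : ∀ a b → (1ℚ * a) * (1ℚ * b) ≡ 1ℚ * (a * b)
  shape = solve-∀ ℚ-ring
dilate-⊛ c A B (suc n) = begin
  (∂ (dilate c A) ⊛ dilate c B) n + (dilate c A ⊛ ∂ (dilate c B)) n
    ≡⟨ cong₂ _+_ (⊛-congʳ (dilate c B) (λ k → *-assoc c (c ^ℚ k) (A (suc k))) n)
                 (⊛-congˡ (dilate c A) (λ k → *-assoc c (c ^ℚ k) (B (suc k))) n) ⟩
  (c ∙ dilate c (∂ A) ⊛ dilate c B) n + (dilate c A ⊛ c ∙ dilate c (∂ B)) n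
    ≡⟨ cong₂ _+_ (∙-⊛-assoc c (dilate c (∂ A)) (dilate c B) n)
                 (⊛-∙-assoc c (dilate c A) (dilate c (∂ B)) n) ⟩
  c * (dilate c (∂ A) ⊛ dilate c B) n + c * (dilate c A ⊛ dilate c (∂ B)) n
    ≡⟨ cong₂ (λ u v → c * u + c * v) (dilate-⊛ c (∂ A) B n) (dilate-⊛ c A (∂ B) n) ⟩
  c * (c ^ℚ n * (∂ A ⊛ B) n) + c * (c ^ℚ n * (A ⊛ ∂ B) n)
    ≡⟨ shape c (c ^ℚ n) ((∂ A ⊛ B) n) ((A ⊛ ∂ B) n) ⟩
  dilate c (A ⊛ B) (suc n) ∎
  where
  open ≡-Reasoning
  shape : ∀ c e u v → c * (e * u) + c * (e * v) ≡ (c * e) * (u + v)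
  shape = solve-∀ ℚ-ring

dilate-exp : ∀ c z → dilate c (exp z) ≗ exp (c * z)
dilate-exp c z zero    = *-identityˡ 1ℚ
dilate-exp c z (suc n) = begin
  (c * c ^ℚ n) * (z * z ^ℚ n)  ≡⟨ shape c z (c ^ℚ n) (z ^ℚ n) ⟩
  (c * z) * (c ^ℚ n * z ^ℚ n)  ≡⟨ cong ((c * z) *_) (dilate-exp c z n) ⟩
  (c * z) * (c * z) ^ℚ n       ∎
  where
  open ≡-Reasoning
  shape : ∀ c z u v → (c * u) * (z * v) ≡ (c * z) * (u * v)
  shape = solve-∀ ℚ-ring

dilate-1ˢ : ∀ c → dilate c 1ˢ ≗ 1ˢ
dilate-1ˢ c zero    = refl
dilate-1ˢ c (suc n) = *-zeroʳ (c ^ℚ suc n)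

dilate-tˢ : ∀ c → dilate c tˢ ≗ c ∙ tˢ
dilate-tˢ c zero          = trans (*-zeroʳ 1ℚ) (sym (*-zeroʳ c))
dilate-tˢ c (suc zero)    = *-identityʳ (c * 1ℚ)
dilate-tˢ c (suc (suc n)) = trans (*-zeroʳ (c ^ℚ suc (suc n))) (sym (*-zeroʳ c))

dilate-sumSeq : ∀ c m A → dilate c (sumSeq m A) ≗ sumSeq m (dilate c ∘ A)
dilate-sumSeq c m A n = sym (sumBelow-*ˡ m (c ^ℚ n) (λ j → A j n))

bernoulliˢ : Seq
bernoulliˢ n = bernoulli n

bernoulli-suc : ∀ n →
  bernoulli (suc n) ≡ - ((+ 1 / suc (suc n)) * sumTo n (λ j → ℕ→ℚ (suc (suc n) C j) * bernoulli j))
bernoulli-suc n =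
  trans (topEntry n) (cong (λ s → - ((+ 1 / suc (suc n)) * s)) (sumBelow-cong-< (suc n) stable))
  where
  topEntry : ∀ n → bernoulli (suc n)
    ≡ - ((+ 1 / suc (suc n)) * sumTo n (λ j → ℕ→ℚ (suc (suc n) C j) * bernUpTo n j))
  topEntry n with suc n ℕ.≤? n
  ... | yes 1+n≤n = ⊥-elim (ℕ.n≮n n 1+n≤n)
  ... | no _      = refl
  bernUpTo-stable : ∀ n k → k ≤ n → bernUpTo n k ≡ bernoulli k
  bernUpTo-stable zero    .zero z≤n = refl
  bernUpTo-stable (suc n) k k≤1+n with k ℕ.≤? n
  ... | yes k≤n = bernUpTo-stable n k k≤n
  ... | no  k≰n = trans (sym (topEntry n)) (cong bernoulli (ℕ.≤-antisym (ℕ.≰⇒> k≰n) k≤1+n))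
  stable : ∀ j → j < suc n →
    ℕ→ℚ (suc (suc n) C j) * bernUpTo n j ≡ ℕ→ℚ (suc (suc n) C j) * bernoulli j
  stable j j<1+n = cong (ℕ→ℚ (suc (suc n) C j) *_) (bernUpTo-stable n j (ℕ.≤-pred j<1+n))

bernoulli-recurrence : ∀ n → sumTo (suc n) (λ k → ℕ→ℚ (suc (suc n) C k) * bernoulli k) ≡ 0ℚ
bernoulli-recurrence n = begin
  S + ℕ→ℚ (suc (suc n) C suc n) * bernoulli (suc n)
    ≡⟨ cong₂ (λ c b → S + ℕ→ℚ c * b) [n+1]Cn≡n+1 (bernoulli-suc n) ⟩
  S + d * (- (d⁻¹ * S))
    ≡⟨ shape S d d⁻¹ ⟩
  S - (d⁻¹ * d) * S
    ≡⟨ cong (λ e → S - e * S) (a/d*d≡a 1 (suc (suc n))) ⟩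
  S - 1ℚ * S
    ≡⟨ cancel S ⟩
  0ℚ ∎
  where
  open ≡-Reasoning
  S = sumTo n (λ k → ℕ→ℚ (suc (suc n) C k) * bernoulli k)
  d = ℕ→ℚ (suc (suc n))
  d⁻¹ = + 1 / suc (suc n)
  [n+1]Cn≡n+1 : suc (suc n) C suc n ≡ suc (suc n)
  [n+1]Cn≡n+1 = trans (ℕ.nCk≡nC[n∸k] (ℕ.n≤1+n (suc n)))
                  (trans (cong (suc (suc n) C_) (ℕ.m+n∸n≡m 1 (suc n))) (ℕ.nC1≡n (suc (suc n))))
  shape : ∀ s a b → s + a * (- (b * s)) ≡ s - (b * a) * s
  shape = solve-∀ ℚ-ring
  cancel : ∀ s → s - 1ℚ * s ≡ 0ℚ
  cancel = solve-∀ ℚ-ring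

bernoulliˢ⊛expm1 : bernoulliˢ ⊛ expm1 ≗ tˢ
bernoulliˢ⊛expm1 zero    = *-zeroʳ (bernoulli 0)
bernoulliˢ⊛expm1 (suc n) = begin
  (bernoulliˢ ⊛ expm1) (suc n)
    ≡⟨ ⊛-binomial bernoulliˢ expm1 (suc n) ⟩
  sumTo n term + ℕ→ℚ (suc n C suc n) * (bernoulli (suc n) * expm1 (n ∸ n))
    ≡⟨ cong₂ (λ s i → s + ℕ→ℚ (suc n C suc n) * (bernoulli (suc n) * expm1 i))
             (sumBelow-cong-< (suc n) expm1-positive) (ℕ.n∸n≡0 n) ⟩
  S + ℕ→ℚ (suc n C suc n) * (bernoulli (suc n) * 0ℚ)
    ≡⟨ vanish S (ℕ→ℚ (suc n C suc n)) (bernoulli (suc n)) ⟩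
  S
    ≡⟨ lowerSum n ⟩
  tˢ (suc n) ∎
  where
  open ≡-Reasoning
  term : ℕ → ℚ
  term k = ℕ→ℚ (suc n C k) * (bernoulli k * expm1 (suc n ∸ k))
  S = sumTo n (λ k → ℕ→ℚ (suc n C k) * bernoulli k)
  expm1-positive : ∀ k → k < suc n → term k ≡ ℕ→ℚ (suc n C k) * bernoulli k
  expm1-positive k k<1+n = cong (ℕ→ℚ (suc n C k) *_) (trans
    (cong (λ i → bernoulli k * expm1 i) (ℕ.+-∸-assoc 1 (ℕ.≤-pred k<1+n))) (*-identityʳ (bernoulli k)))
  vanish : ∀ s c b → s + c * (b * 0ℚ) ≡ s
  vanish = solve-∀ ℚ-ring
  lowerSum : ∀ n → sumTo n (λ k → ℕ→ℚ (suc n C k) * bernoulli k) ≡ tˢ (suc n)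
  lowerSum zero    = refl
  lowerSum (suc n) = bernoulli-recurrence n

bernoulliˢ⊛expm1/t : bernoulliˢ ⊛ expm1/t ≗ 1ˢ
bernoulliˢ⊛expm1/t = ⊛-tˢ-cancel (begin
  (bernoulliˢ ⊛ expm1/t) ⊛ tˢ  ≈⟨ ⊛-assoc bernoulliˢ expm1/t tˢ ⟩
  bernoulliˢ ⊛ (expm1/t ⊛ tˢ)  ≈⟨ ⊛-congˡ bernoulliˢ expm1/t⊛tˢ ⟩
  bernoulliˢ ⊛ expm1           ≈⟨ bernoulliˢ⊛expm1 ⟩
  tˢ                           ≈⟨ ⊛-identityˡ tˢ ⟨
  1ˢ ⊛ tˢ                      ∎)
  where open ≗-Reasoning

expm1-division : ∀ {A B} → A ⊛ expm1 ≗ B ⊛ tˢ → A ≗ bernoulliˢ ⊛ B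
expm1-division {A} {B} A⊛expm1≗B⊛tˢ = begin
  A                                 ≈⟨ ⊛-identityʳ A ⟨
  A ⊛ 1ˢ                            ≈⟨ ⊛-congˡ A bernoulliˢ⊛expm1/t ⟨
  A ⊛ (bernoulliˢ ⊛ expm1/t)        ≈⟨ ⊛-assoc A bernoulliˢ expm1/t ⟨
  A ⊛ bernoulliˢ ⊛ expm1/t          ≈⟨ ⊛-right-comm A bernoulliˢ expm1/t ⟩
  A ⊛ expm1/t ⊛ bernoulliˢ          ≈⟨ ⊛-congʳ bernoulliˢ A⊛expm1/t≗B ⟩
  B ⊛ bernoulliˢ                    ≈⟨ ⊛-comm B bernoulliˢ ⟩
  bernoulliˢ ⊛ B                    ∎
  where
  open ≗-Reasoning
  A⊛expm1/t≗B : A ⊛ expm1/t ≗ B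
  A⊛expm1/t≗B = ⊛-tˢ-cancel (begin
    (A ⊛ expm1/t) ⊛ tˢ  ≈⟨ ⊛-assoc A expm1/t tˢ ⟩
    A ⊛ (expm1/t ⊛ tˢ)  ≈⟨ ⊛-congˡ A expm1/t⊛tˢ ⟩
    A ⊛ expm1           ≈⟨ A⊛expm1≗B⊛tˢ ⟩
    B ⊛ tˢ              ∎)

expSum : ℕ → Seq
expSum m = sumSeq m (exp ∘ ℕ→ℚ)

expSum⊛expm1 : ∀ m → expSum m ⊛ expm1 ≗ dilate (ℕ→ℚ m) expm1
expSum⊛expm1 m n = begin
  (expSum m ⊛ expm1) n                                    ≡⟨ ⊛-comm (expSum m) expm1 n ⟩
  (expm1 ⊛ expSum m) n                                    ≡⟨ ⊛-sumSeq m expm1 (exp ∘ ℕ→ℚ) n ⟩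
  sumBelow m (λ j → (expm1 ⊛ exp (ℕ→ℚ j)) n)              ≡⟨ sumBelow-cong m successive ⟩
  sumBelow m (λ j → exp (ℕ→ℚ (suc j)) n - exp (ℕ→ℚ j) n)  ≡⟨ sumBelow-telescope m (λ j → exp (ℕ→ℚ j) n) ⟩
  exp (ℕ→ℚ m) n - exp 0ℚ n                                ≡⟨ boundary n ⟩
  dilate (ℕ→ℚ m) expm1 n                                  ∎
  where
  open ≡-Reasoning
  successive : ∀ j → (expm1 ⊛ exp (ℕ→ℚ j)) n ≡ exp (ℕ→ℚ (suc j)) n - exp (ℕ→ℚ j) n
  successive j = trans (expm1⊛exp (ℕ→ℚ j) n) (cong (λ z → exp z n - exp (ℕ→ℚ j) n) (sym (ℕ→ℚ-suc j)))
  boundary : ∀ n → exp (ℕ→ℚ m) n - exp 0ℚ n ≡ dilate (ℕ→ℚ m) expm1 n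
  boundary zero    = refl
  boundary (suc n) = begin
    ℕ→ℚ m ^ℚ suc n - 0ℚ * 0ℚ ^ℚ n ≡⟨ cong (λ z → ℕ→ℚ m ^ℚ suc n - z) (*-zeroˡ (0ℚ ^ℚ n)) ⟩
    ℕ→ℚ m ^ℚ suc n + 0ℚ          ≡⟨ +-identityʳ (ℕ→ℚ m ^ℚ suc n) ⟩
    ℕ→ℚ m ^ℚ suc n               ≡⟨ *-identityʳ (ℕ→ℚ m ^ℚ suc n) ⟨
    ℕ→ℚ m ^ℚ suc n * 1ℚ          ∎

bernoulliˢ-multiplication : ∀ m → dilate (ℕ→ℚ m) bernoulliˢ ⊛ expSum m ≗ ℕ→ℚ m ∙ bernoulliˢ
bernoulliˢ-multiplication m = begin
  dilate c bernoulliˢ ⊛ expSum m  ≈⟨ expm1-division times-expm1 ⟩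
  bernoulliˢ ⊛ c ∙ 1ˢ             ≈⟨ ⊛-∙-assoc c bernoulliˢ 1ˢ ⟩
  c ∙ (bernoulliˢ ⊛ 1ˢ)           ≈⟨ ∙-congˡ c (⊛-identityʳ bernoulliˢ) ⟩
  c ∙ bernoulliˢ                  ∎
  where
  open ≗-Reasoning
  c = ℕ→ℚ m
  times-expm1 : dilate c bernoulliˢ ⊛ expSum m ⊛ expm1 ≗ c ∙ 1ˢ ⊛ tˢ
  times-expm1 = begin
    dilate c bernoulliˢ ⊛ expSum m ⊛ expm1       ≈⟨ ⊛-assoc (dilate c bernoulliˢ) (expSum m) expm1 ⟩
    dilate c bernoulliˢ ⊛ (expSum m ⊛ expm1)     ≈⟨ ⊛-congˡ (dilate c bernoulliˢ) (expSum⊛expm1 m) ⟩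
    dilate c bernoulliˢ ⊛ dilate c expm1         ≈⟨ dilate-⊛ c bernoulliˢ expm1 ⟩
    dilate c (bernoulliˢ ⊛ expm1)                ≈⟨ dilate-cong c bernoulliˢ⊛expm1 ⟩
    dilate c tˢ                                  ≈⟨ dilate-tˢ c ⟩
    c ∙ tˢ                                       ≈⟨ ∙-congˡ c (⊛-identityˡ tˢ) ⟨
    c ∙ (1ˢ ⊛ tˢ)                                ≈⟨ ∙-⊛-assoc c 1ˢ tˢ ⟨
    c ∙ 1ˢ ⊛ tˢ                                  ∎

bernoulliPolyˢ : ℚ → Seq
bernoulliPolyˢ z n = bernoulliPoly n z

bernoulliPolyˢ≗bernoulliˢ⊛exp : ∀ z → bernoulliPolyˢ z ≗ bernoulliˢ ⊛ exp z
bernoulliPolyˢ≗bernoulliˢ⊛exp z n = sym (trans (⊛-binomial bernoulliˢ (exp z) n)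
  (sumBelow-cong (suc n) (λ k → sym (*-assoc (ℕ→ℚ (n C k)) (bernoulli k) (z ^ℚ (n ∸ k))))))

m*[x+j/m]≡m*x+j : ∀ m .{{_ : NonZero m}} x j → ℕ→ℚ m * (x + + j / m) ≡ ℕ→ℚ m * x + ℕ→ℚ j
m*[x+j/m]≡m*x+j m x j = trans (*-distribˡ-+ (ℕ→ℚ m) x (+ j / m))
  (cong (_+_ (ℕ→ℚ m * x)) (trans (*-comm (ℕ→ℚ m) (+ j / m)) (a/d*d≡a j m)))

bernoulliPoly-multiplication : ∀ m .{{_ : NonZero m}} x →
  sumSeq m (λ j → dilate (ℕ→ℚ m) (bernoulliPolyˢ (x + + j / m))) ≗ ℕ→ℚ m ∙ bernoulliPolyˢ (ℕ→ℚ m * x)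
bernoulliPoly-multiplication m x = begin
  sumSeq m (λ j → dilate c (bernoulliPolyˢ (shift j)))  ≈⟨ sumSeq-cong m dilated-term ⟩
  sumSeq m (λ j → D ⊛ exp y ⊛ exp (ℕ→ℚ j))             ≈⟨ ⊛-sumSeq m (D ⊛ exp y) (exp ∘ ℕ→ℚ) ⟨
  D ⊛ exp y ⊛ expSum m                                 ≈⟨ ⊛-right-comm D (exp y) (expSum m) ⟩
  D ⊛ expSum m ⊛ exp y                                 ≈⟨ ⊛-congʳ (exp y) (bernoulliˢ-multiplication m) ⟩
  c ∙ bernoulliˢ ⊛ exp y                               ≈⟨ ∙-⊛-assoc c bernoulliˢ (exp y) ⟩
  c ∙ (bernoulliˢ ⊛ exp y)                             ≈⟨ ∙-congˡ c (bernoulliPolyˢ≗bernoulliˢ⊛exp y) ⟨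
  c ∙ bernoulliPolyˢ y                                 ∎
  where
  open ≗-Reasoning
  c = ℕ→ℚ m
  y = c * x
  D = dilate c bernoulliˢ
  shift : ℕ → ℚ
  shift j = x + + j / m
  dilated-term : ∀ j → dilate c (bernoulliPolyˢ (shift j)) ≗ D ⊛ exp y ⊛ exp (ℕ→ℚ j)
  dilated-term j = begin
    dilate c (bernoulliPolyˢ (shift j))    ≈⟨ dilate-cong c (bernoulliPolyˢ≗bernoulliˢ⊛exp (shift j)) ⟩
    dilate c (bernoulliˢ ⊛ exp (shift j))  ≈⟨ dilate-⊛ c bernoulliˢ (exp (shift j)) ⟨
    D ⊛ dilate c (exp (shift j))           ≈⟨ ⊛-congˡ D (dilate-exp c (shift j)) ⟩
    D ⊛ exp (c * shift j)                  ≡⟨ cong (λ z → D ⊛ exp z) (m*[x+j/m]≡m*x+j m x j) ⟩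
    D ⊛ exp (y + ℕ→ℚ j)                    ≈⟨ ⊛-congˡ D (exp-⊛ y (ℕ→ℚ j)) ⟨
    D ⊛ (exp y ⊛ exp (ℕ→ℚ j))              ≈⟨ ⊛-assoc D (exp y) (exp (ℕ→ℚ j)) ⟨
    D ⊛ exp y ⊛ exp (ℕ→ℚ j)                ∎

pBernoulliˢ : ℕ → Seq
pBernoulliˢ p n = pBernoulli n p

κ ρ : ℕ → ℚ
κ p = + (suc p ℕ.* suc p) / suc (suc p)
ρ p = + suc p / suc (suc p)

ρ*[2+p]≡1+p : ∀ p → ρ p * ℕ→ℚ (suc (suc p)) ≡ ℕ→ℚ (suc p)
ρ*[2+p]≡1+p p = a/d*d≡a (suc p) (suc (suc p))

κ≡[1+p]*ρ : ∀ p → κ p ≡ ℕ→ℚ (suc p) * ρ p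
κ≡[1+p]*ρ p = *-cancelˡ-ℕ→ℚ (suc (suc p)) (begin
  p₂ * κ p         ≡⟨ *-comm p₂ (κ p) ⟩
  κ p * p₂         ≡⟨ a/d*d≡a (suc p ℕ.* suc p) (suc (suc p)) ⟩
  ℕ→ℚ (suc p ℕ.* suc p) ≡⟨ ℕ→ℚ-homo-* (suc p) (suc p) ⟩
  p₁ * p₁          ≡⟨ cong (p₁ *_) (ρ*[2+p]≡1+p p) ⟨
  p₁ * (ρ p * p₂)  ≡⟨ shape p₁ (ρ p) p₂ ⟩
  p₂ * (p₁ * ρ p)  ∎)
  where
  open ≡-Reasoning
  p₁ = ℕ→ℚ (suc p)
  p₂ = ℕ→ℚ (suc (suc p))
  shape : ∀ a b c → a * (b * c) ≡ c * (a * b)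
  shape = solve-∀ ℚ-ring

∂-pBernoulliˢ : ∀ p → ∂ (pBernoulliˢ p) ≗ ℕ→ℚ p ∙ pBernoulliˢ p ⊖ κ p ∙ pBernoulliˢ (suc p)
∂-pBernoulliˢ p n = refl

∂-expm1 : ∂ expm1 ≗ expm1 ⊕ 1ˢ
∂-expm1 zero    = refl
∂-expm1 (suc n) = refl

-- Φ p is Pₚ(t)(eᵗ − 1).  By ∂-Φ-leibniz the ODE  Φₚ' = (p + 1) − p Pₚ  is equivalent to
-- odeDefect p ≗ 0ˢ, which is proved for all p at once by induction on the coefficient index.
Φ : ℕ → Seq
Φ p = pBernoulliˢ p ⊛ expm1

odeDefect : ℕ → Seq
odeDefect p = Φ p ⊕ pBernoulliˢ p ⊖ ρ p ∙ Φ (suc p) ⊖ 1ˢ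

∂-Φ-leibniz : ∀ p → ∂ (Φ p) ≗ ℕ→ℚ p ∙ Φ p ⊖ κ p ∙ Φ (suc p) ⊕ (Φ p ⊕ pBernoulliˢ p)
∂-Φ-leibniz p n = cong₂ _+_ recurrence-part expm1-part
  where
  open ≡-Reasoning
  P = pBernoulliˢ p
  P′ = pBernoulliˢ (suc p)
  recurrence-part : (∂ P ⊛ expm1) n ≡ ℕ→ℚ p * Φ p n - κ p * Φ (suc p) n
  recurrence-part = begin
    (∂ P ⊛ expm1) n
      ≡⟨ ⊛-congʳ expm1 (∂-pBernoulliˢ p) n ⟩
    ((ℕ→ℚ p ∙ P ⊖ κ p ∙ P′) ⊛ expm1) n
      ≡⟨ ⊛-distribʳ-⊖ (ℕ→ℚ p ∙ P) (κ p ∙ P′) expm1 n ⟩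
    (ℕ→ℚ p ∙ P ⊛ expm1) n - (κ p ∙ P′ ⊛ expm1) n
      ≡⟨ cong₂ _-_ (∙-⊛-assoc (ℕ→ℚ p) P expm1 n) (∙-⊛-assoc (κ p) P′ expm1 n) ⟩
    ℕ→ℚ p * Φ p n - κ p * Φ (suc p) n ∎
  expm1-part : (P ⊛ ∂ expm1) n ≡ Φ p n + P n
  expm1-part = begin
    (P ⊛ ∂ expm1) n         ≡⟨ ⊛-congˡ P ∂-expm1 n ⟩
    (P ⊛ (expm1 ⊕ 1ˢ)) n    ≡⟨ ⊛-distribˡ-⊕ P expm1 1ˢ n ⟩
    Φ p n + (P ⊛ 1ˢ) n      ≡⟨ cong (_+_ (Φ p n)) (⊛-identityʳ P n) ⟩
    Φ p n + P n             ∎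

-- After matching, only ρ₀ q' = q is not a substitution; it kills the remainder term that the ring
-- solver leaves over.
defect-identity : ∀ p̂ {q q' κ₀ κ₁} ρ₀ ρ₁ Φ₀ Φ₁ Φ₂ P₀ P₁ δ →
  q ≡ 1ℚ + p̂ → q' ≡ 1ℚ + q → κ₀ ≡ q * ρ₀ → κ₁ ≡ q' * ρ₁ → ρ₀ * q' ≡ q →
  (p̂ * Φ₀ - κ₀ * Φ₁ + (Φ₀ + P₀)) + (p̂ * P₀ - κ₀ * P₁) - ρ₀ * (q * Φ₁ - κ₁ * Φ₂ + (Φ₁ + P₁)) - 0ℚ
    ≡ q * ((Φ₀ + P₀ - ρ₀ * Φ₁ - δ) - (Φ₁ + P₁ - ρ₁ * Φ₂ - δ))
defect-identity p̂ ρ₀ ρ₁ Φ₀ Φ₁ Φ₂ P₀ P₁ δ refl refl refl refl ρ₀q'≡q =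
  trans (expand p̂ ρ₀ ρ₁ Φ₀ Φ₁ Φ₂ P₀ P₁ δ)
    (trans (cong (λ e → main + ((1ℚ + p̂) - e) * remainder) ρ₀q'≡q)
           (remainder-vanishes (1ℚ + p̂) main remainder))
  where
  main = (1ℚ + p̂) * ((Φ₀ + P₀ - ρ₀ * Φ₁ - δ) - (Φ₁ + P₁ - ρ₁ * Φ₂ - δ))
  remainder = Φ₁ + P₁ - ρ₁ * Φ₂
  expand : ∀ p̂ ρ₀ ρ₁ Φ₀ Φ₁ Φ₂ P₀ P₁ δ →
    (p̂ * Φ₀ - ((1ℚ + p̂) * ρ₀) * Φ₁ + (Φ₀ + P₀)) + (p̂ * P₀ - ((1ℚ + p̂) * ρ₀) * P₁)
      - ρ₀ * ((1ℚ + p̂) * Φ₁ - ((1ℚ + (1ℚ + p̂)) * ρ₁) * Φ₂ + (Φ₁ + P₁)) - 0ℚ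
    ≡ (1ℚ + p̂) * ((Φ₀ + P₀ - ρ₀ * Φ₁ - δ) - (Φ₁ + P₁ - ρ₁ * Φ₂ - δ))
      + ((1ℚ + p̂) - ρ₀ * (1ℚ + (1ℚ + p̂))) * (Φ₁ + P₁ - ρ₁ * Φ₂)
  expand = solve-∀ ℚ-ring
  remainder-vanishes : ∀ q a r → a + (q - q) * r ≡ a
  remainder-vanishes = solve-∀ ℚ-ring

∂-odeDefect : ∀ p → ∂ (odeDefect p) ≗ ℕ→ℚ (suc p) ∙ (odeDefect p ⊖ odeDefect (suc p))
∂-odeDefect p n = trans
  (cong₂ (λ u v → u + pBernoulli (suc n) p - ρ p * v - 0ℚ) (∂-Φ-leibniz p n) (∂-Φ-leibniz (suc p) n))
  (defect-identity (ℕ→ℚ p) (ρ p) (ρ (suc p)) (Φ p n) (Φ (suc p) n) (Φ (suc (suc p)) n)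
    (pBernoulli n p) (pBernoulli n (suc p)) (1ˢ n)
    (ℕ→ℚ-suc p) (ℕ→ℚ-suc (suc p)) (κ≡[1+p]*ρ p) (κ≡[1+p]*ρ (suc p)) (ρ*[2+p]≡1+p p))

odeDefect≗0ˢ : ∀ p → odeDefect p ≗ 0ˢ
odeDefect≗0ˢ p zero    = initial (ρ p)
  where
  initial : ∀ r → 1ℚ * 0ℚ + 1ℚ - r * (1ℚ * 0ℚ) - 1ℚ ≡ 0ℚ
  initial = solve-∀ ℚ-ring
odeDefect≗0ˢ p (suc n) = trans (∂-odeDefect p n)
  (trans (cong₂ (λ u v → ℕ→ℚ (suc p) * (u - v)) (odeDefect≗0ˢ p n) (odeDefect≗0ˢ (suc p) n))
         (vanish (ℕ→ℚ (suc p))))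
  where
  vanish : ∀ q → q * (0ℚ - 0ℚ) ≡ 0ℚ
  vanish = solve-∀ ℚ-ring

∂-Φ : ∀ p → ∂ (Φ p) ≗ ℕ→ℚ (suc p) ∙ 1ˢ ⊖ ℕ→ℚ p ∙ pBernoulliˢ p
∂-Φ p n = trans (∂-Φ-leibniz p n)
  (ode-identity (ℕ→ℚ p) (ρ p) (Φ p n) (Φ (suc p) n) (pBernoulli n p) (1ˢ n)
    (ℕ→ℚ-suc p) (κ≡[1+p]*ρ p) (odeDefect≗0ˢ p n))
  where
  ode-identity : ∀ p̂ {q κ₀} ρ₀ Φ₀ Φ₁ P₀ δ → q ≡ 1ℚ + p̂ → κ₀ ≡ q * ρ₀ →
    Φ₀ + P₀ - ρ₀ * Φ₁ - δ ≡ 0ℚ → p̂ * Φ₀ - κ₀ * Φ₁ + (Φ₀ + P₀) ≡ q * δ - p̂ * P₀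
  ode-identity p̂ ρ₀ Φ₀ Φ₁ P₀ δ refl refl defect≡0 =
    trans (expand p̂ ρ₀ Φ₀ Φ₁ P₀ δ)
      (trans (cong (λ e → (1ℚ + p̂) * δ - p̂ * P₀ + (1ℚ + p̂) * e) defect≡0) (drop (1ℚ + p̂) (p̂ * P₀) δ))
    where
    expand : ∀ p̂ ρ₀ Φ₀ Φ₁ P₀ δ → p̂ * Φ₀ - ((1ℚ + p̂) * ρ₀) * Φ₁ + (Φ₀ + P₀)
      ≡ (1ℚ + p̂) * δ - p̂ * P₀ + (1ℚ + p̂) * (Φ₀ + P₀ - ρ₀ * Φ₁ - δ)
    expand = solve-∀ ℚ-ring
    drop : ∀ q a δ → q * δ - a + q * 0ℚ ≡ q * δ - a
    drop = solve-∀ ℚ-ring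

-- pBernoulliMeanˢ p is (1/t)∫₀ᵗ Pₚ, and pBernoulliQuotientˢ p turns out to be Pₚ(t)(eᵗ − 1)/t.
pBernoulliMeanˢ : ℕ → Seq
pBernoulliMeanˢ p n = pBernoulli n p * (+ 1 / suc n)

pBernoulliQuotientˢ : ℕ → Seq
pBernoulliQuotientˢ p = ℕ→ℚ (suc p) ∙ 1ˢ ⊖ ℕ→ℚ p ∙ pBernoulliMeanˢ p

pBernoulliQuotientˢ⊛tˢ : ∀ p → pBernoulliQuotientˢ p ⊛ tˢ ≗ Φ p
pBernoulliQuotientˢ⊛tˢ p zero    =
  trans (*-zeroʳ (pBernoulliQuotientˢ p 0)) (sym (*-zeroʳ (pBernoulli 0 p)))
pBernoulliQuotientˢ⊛tˢ p (suc n) = begin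
  (pBernoulliQuotientˢ p ⊛ tˢ) (suc n)
    ≡⟨ ⊛-tˢ (pBernoulliQuotientˢ p) n ⟩
  s * (q * 1ˢ n - p̂ * (pBernoulli n p * s⁻¹))
    ≡⟨ expand s q p̂ (1ˢ n) (pBernoulli n p) s⁻¹ ⟩
  q * (s * 1ˢ n) - p̂ * pBernoulli n p * (s⁻¹ * s)
    ≡⟨ cong₂ (λ u v → q * u - p̂ * pBernoulli n p * v) (s*1ˢ n) (a/d*d≡a 1 (suc n)) ⟩
  q * 1ˢ n - p̂ * pBernoulli n p * 1ℚ
    ≡⟨ cong (_-_ (q * 1ˢ n)) (*-identityʳ (p̂ * pBernoulli n p)) ⟩
  q * 1ˢ n - p̂ * pBernoulli n p
    ≡⟨ ∂-Φ p n ⟨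
  Φ p (suc n) ∎
  where
  open ≡-Reasoning
  q = ℕ→ℚ (suc p)
  p̂ = ℕ→ℚ p
  s = ℕ→ℚ (suc n)
  s⁻¹ = + 1 / suc n
  expand : ∀ s q p̂ e P u → s * (q * e - p̂ * (P * u)) ≡ q * (s * e) - p̂ * P * (u * s)
  expand = solve-∀ ℚ-ring
  s*1ˢ : ∀ n → ℕ→ℚ (suc n) * 1ˢ n ≡ 1ˢ n
  s*1ˢ zero    = refl
  s*1ˢ (suc n) = *-zeroʳ (ℕ→ℚ (suc (suc n)))

pBernoulliˢ≗bernoulliˢ⊛quotient : ∀ p → pBernoulliˢ p ≗ bernoulliˢ ⊛ pBernoulliQuotientˢ p
pBernoulliˢ≗bernoulliˢ⊛quotient p = expm1-division (λ n → sym (pBernoulliQuotientˢ⊛tˢ p n))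

pBernoulliPolyˢ : ℕ → ℚ → Seq
pBernoulliPolyˢ p z n = pBernoulliPoly n p z

pBernoulliPolyˢ≗quotient⊛bernoulliPolyˢ : ∀ p z →
  pBernoulliPolyˢ p z ≗ pBernoulliQuotientˢ p ⊛ bernoulliPolyˢ z
pBernoulliPolyˢ≗quotient⊛bernoulliPolyˢ p z = begin
  pBernoulliPolyˢ p z                       ≈⟨ as-product ⟩
  pBernoulliˢ p ⊛ exp z                     ≈⟨ ⊛-congʳ (exp z) (pBernoulliˢ≗bernoulliˢ⊛quotient p) ⟩
  bernoulliˢ ⊛ Q ⊛ exp z                    ≈⟨ ⊛-right-comm bernoulliˢ Q (exp z) ⟩
  bernoulliˢ ⊛ exp z ⊛ Q                    ≈⟨ ⊛-comm (bernoulliˢ ⊛ exp z) Q ⟩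
  Q ⊛ (bernoulliˢ ⊛ exp z)                  ≈⟨ ⊛-congˡ Q (bernoulliPolyˢ≗bernoulliˢ⊛exp z) ⟨
  Q ⊛ bernoulliPolyˢ z                      ∎
  where
  open ≗-Reasoning
  Q = pBernoulliQuotientˢ p
  as-product : pBernoulliPolyˢ p z ≗ pBernoulliˢ p ⊛ exp z
  as-product n = sym (trans (⊛-binomial (pBernoulliˢ p) (exp z) n)
    (sumBelow-cong (suc n) (λ k → shape (ℕ→ℚ (n C k)) (pBernoulli k p) (z ^ℚ (n ∸ k)))))
    where
    shape : ∀ c b e → c * (b * e) ≡ c * e * b
    shape = solve-∀ ℚ-ring

pBernoulliPoly-multiplication : ∀ m .{{_ : NonZero m}} p x →
  dilate (ℕ→ℚ m) (sumSeq m (λ j → pBernoulliPolyˢ p (x + + j / m)))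
    ≗ ℕ→ℚ m ∙ (dilate (ℕ→ℚ m) (pBernoulliQuotientˢ p) ⊛ bernoulliPolyˢ (ℕ→ℚ m * x))
pBernoulliPoly-multiplication m p x = begin
  dilate c (sumSeq m (λ j → pBernoulliPolyˢ p (shift j)))
    ≈⟨ dilate-sumSeq c m (λ j → pBernoulliPolyˢ p (shift j)) ⟩
  sumSeq m (λ j → dilate c (pBernoulliPolyˢ p (shift j)))
    ≈⟨ sumSeq-cong m (λ j → dilate-cong c (pBernoulliPolyˢ≗quotient⊛bernoulliPolyˢ p (shift j))) ⟩
  sumSeq m (λ j → dilate c (Q ⊛ bernoulliPolyˢ (shift j)))
    ≈⟨ sumSeq-cong m (λ j → dilate-⊛ c Q (bernoulliPolyˢ (shift j))) ⟨
  sumSeq m (λ j → dilate c Q ⊛ dilate c (bernoulliPolyˢ (shift j)))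
    ≈⟨ ⊛-sumSeq m (dilate c Q) (λ j → dilate c (bernoulliPolyˢ (shift j))) ⟨
  dilate c Q ⊛ sumSeq m (λ j → dilate c (bernoulliPolyˢ (shift j)))
    ≈⟨ ⊛-congˡ (dilate c Q) (bernoulliPoly-multiplication m x) ⟩
  dilate c Q ⊛ c ∙ bernoulliPolyˢ (c * x)
    ≈⟨ ⊛-∙-assoc c (dilate c Q) (bernoulliPolyˢ (c * x)) ⟩
  c ∙ (dilate c Q ⊛ bernoulliPolyˢ (c * x)) ∎
  where
  open ≗-Reasoning
  c = ℕ→ℚ m
  Q = pBernoulliQuotientˢ p
  shift : ℕ → ℚ
  shift j = x + + j / m

dilate-quotient-⊛ : ∀ c p W →
  dilate c (pBernoulliQuotientˢ p) ⊛ W ≗ ℕ→ℚ (suc p) ∙ W ⊖ ℕ→ℚ p ∙ (dilate c (pBernoulliMeanˢ p) ⊛ W)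
dilate-quotient-⊛ c p W = begin
  dilate c (pBernoulliQuotientˢ p) ⊛ W  ≈⟨ ⊛-congʳ W dilated ⟩
  (q ∙ 1ˢ ⊖ p̂ ∙ M) ⊛ W                  ≈⟨ ⊛-distribʳ-⊖ (q ∙ 1ˢ) (p̂ ∙ M) W ⟩
  q ∙ 1ˢ ⊛ W ⊖ p̂ ∙ M ⊛ W                ≈⟨ (λ n → cong₂ _-_ (unit n) (∙-⊛-assoc p̂ M W n)) ⟩
  q ∙ W ⊖ p̂ ∙ (M ⊛ W)                   ∎
  where
  open ≗-Reasoning
  q = ℕ→ℚ (suc p)
  p̂ = ℕ→ℚ p
  M = dilate c (pBernoulliMeanˢ p)
  dilated : dilate c (pBernoulliQuotientˢ p) ≗ q ∙ 1ˢ ⊖ p̂ ∙ M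
  dilated n = trans (expand (c ^ℚ n) q (1ˢ n) p̂ (pBernoulliMeanˢ p n))
                    (cong (λ e → q * e - p̂ * M n) (dilate-1ˢ c n))
    where
    expand : ∀ e q d p̂ a → e * (q * d - p̂ * a) ≡ q * (e * d) - p̂ * (e * a)
    expand = solve-∀ ℚ-ring
  unit : q ∙ 1ˢ ⊛ W ≗ q ∙ W
  unit n = trans (∙-⊛-assoc q 1ˢ W n) (∙-congˡ q (⊛-identityˡ W) n)

m*mPowPred≡m^n : ∀ m .{{_ : NonZero m}} n → ℕ→ℚ m * mPowPred m n ≡ ℕ→ℚ m ^ℚ n
m*mPowPred≡m^n m zero    = trans (*-comm (ℕ→ℚ m) (+ 1 / m)) (a/d*d≡a 1 m)
m*mPowPred≡m^n m (suc n) = refl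

theorem4 : (m : ℕ) → .{{_ : NonZero m}} → (n p : ℕ) → (x : ℚ) →
    mPowPred m n * sumBelow m (λ k → pBernoulliPoly n p (x + (+ k / m)))
      ≡ ℕ→ℚ (suc p) * bernoulliPoly n (ℕ→ℚ m * x)
        - ℕ→ℚ p * sumTo n (λ k → ℕ→ℚ (n C k) * (ℕ→ℚ m ^ℚ k) * bernoulliPoly (n ∸ k) (ℕ→ℚ m * x) * pBernoulli k p * (+ 1 / suc k))
theorem4 m n p x = *-cancelˡ-ℕ→ℚ m (begin
  c * (mPowPred m n * L)     ≡⟨ *-assoc c (mPowPred m n) L ⟨
  (c * mPowPred m n) * L     ≡⟨ cong (_* L) (m*mPowPred≡m^n m n) ⟩
  c ^ℚ n * L                 ≡⟨ pBernoulliPoly-multiplication m p x n ⟩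
  c * (dilate c (pBernoulliQuotientˢ p) ⊛ bernoulliPolyˢ y) n
    ≡⟨ cong (c *_) (dilate-quotient-⊛ c p (bernoulliPolyˢ y) n) ⟩
  c * (ℕ→ℚ (suc p) * bernoulliPoly n y - ℕ→ℚ p * (dilate c (pBernoulliMeanˢ p) ⊛ bernoulliPolyˢ y) n)
    ≡⟨ cong (λ s → c * (ℕ→ℚ (suc p) * bernoulliPoly n y - ℕ→ℚ p * s)) binomial-form ⟩
  c * RHS                    ∎)
  where
  open ≡-Reasoning
  c = ℕ→ℚ m
  y = c * x
  L = sumBelow m (λ k → pBernoulliPoly n p (x + (+ k / m)))
  term : ℕ → ℚ
  term k = ℕ→ℚ (n C k) * (c ^ℚ k) * bernoulliPoly (n ∸ k) y * pBernoulli k p * (+ 1 / suc k)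
  RHS = ℕ→ℚ (suc p) * bernoulliPoly n y - ℕ→ℚ p * sumTo n term
  binomial-form : (dilate c (pBernoulliMeanˢ p) ⊛ bernoulliPolyˢ y) n ≡ sumTo n term
  binomial-form = trans (⊛-binomial (dilate c (pBernoulliMeanˢ p)) (bernoulliPolyˢ y) n)
    (sumBelow-cong (suc n) (λ k →
      shape (ℕ→ℚ (n C k)) (c ^ℚ k) (pBernoulli k p) (+ 1 / suc k) (bernoulliPoly (n ∸ k) y)))
    where
    shape : ∀ a e b u B → a * (e * (b * u) * B) ≡ a * e * B * b * u
    shape = solve-∀ ℚ-ring
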